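{- For integers $n,m\ge 2$, the flip graph of $T(2n,2m,2m)$ has at least $2n+2m-3$ components having at least two vertices.
   Context: Write $Z_k=\{0,1,\dots,k-1\}$. For $N\ge1$, $M\ge2$, $1\le R\le M$, $T(N,M,R)$ is the graph with vertex set $\{v_{i,j}: i\in Z_N, j\in Z_M\}$ (second index modulo $M$) and edges $v_{i,j}v_{i,j+1}$, $v_{i,j}v_{i+1,j}$ ($0\le i\le N-2$), $v_{N-1,j}v_{0,j+R}$, embedded on the torus with faces $v_{i,j}v_{i,j+1}v_{i+1,j+1}v_{i+1,j}$ ($0\le i\le N-2$) and $v_{N-1,j}v_{N-1,j+1}v_{0,j+R+1}v_{0,j+R}$. (So $T(2n,2m,2m)$ is the usual $2n\times 2m$ torus.) The flip graph has as vertices the perfect matchings (domino tilings), two adjacent iff their symmetric difference is the boundary of a face. -}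

module Defs where

open import Data.Nat using (ℕ; zero; suc; _+_; _<ᵇ_)
open import Data.Nat.DivMod using (_%_; m%n<n)
open import Data.Fin using (Fin; toℕ; fromℕ<)
open import Data.Bool using (Bool; true; false; if_then_else_; _xor_)
open import Data.Product using (Σ; _×_; _,_; ∃; proj₁)
open import Data.Sum using (_⊎_)
open import Relation.Binary.PropositionalEquality using (_≡_)

addMod : ∀ {M} → Fin M → ℕ → Fin M
addMod {suc k} j r = fromℕ< (m%n<n (toℕ j + r) (suc k))

Vertex : ℕ → ℕ → Set
Vertex N M = Fin N × Fin M

-- Edges of T(N,M,R):
--   (i , j , true)  : the "horizontal" edge v_{i,j} v_{i,j+1}
--   (i , j , false) : the "down" edge v_{i,j} v_{i+1,j} if i ≤ N-2,
--                     and v_{N-1,j} v_{0,j+R} if i = N-1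
Edge : ℕ → ℕ → Set
Edge N M = Fin N × Fin M × Bool

module _ (N M R : ℕ) where

  src : Edge N M → Vertex N M
  src (i , j , _) = (i , j)

  tgt : Edge N M → Vertex N M
  tgt (i , j , true)  = (i , addMod j 1)
  tgt (i , j , false) =
    (addMod i 1 , (if suc (toℕ i) <ᵇ N then j else addMod j R))

  Incident : Vertex N M → Edge N M → Set
  Incident v e = (v ≡ src e) ⊎ (v ≡ tgt e)

  EdgeSet : Set
  EdgeSet = Edge N M → Bool

  IsPerfectMatching : EdgeSet → Set
  IsPerfectMatching P =
    (v : Vertex N M) →
      Σ (Edge N M) λ e → (P e ≡ true) × Incident v e ×
        ((e' : Edge N M) → P e' ≡ true → Incident v e' → e' ≡ e)

  PerfectMatching : Set
  PerfectMatching = Σ EdgeSet IsPerfectMatching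

  -- Faces are indexed by (i , j): the face
  --   v_{i,j} v_{i,j+1} v_{i+1,j+1} v_{i+1,j}            (i ≤ N-2)
  --   v_{N-1,j} v_{N-1,j+1} v_{0,j+R+1} v_{0,j+R}        (i = N-1)
  -- Its boundary consists of: horizontal edge at (i,j), down edges at (i,j)
  -- and (i,j+1), and the horizontal edge at the lower-left corner.
  Face : Set
  Face = Fin N × Fin M

  OnBoundary : Face → Edge N M → Set
  OnBoundary (i , j) e =
    (e ≡ (i , j , true)) ⊎ (e ≡ (i , j , false)) ⊎
    (e ≡ (i , addMod j 1 , false)) ⊎
    (e ≡ (addMod i 1 , (if suc (toℕ i) <ᵇ N then j else addMod j R) , true))

  Flip : PerfectMatching → PerfectMatching → Set
  Flip (P , _) (Q , _) =
    Σ Face λ f → (e : Edge N M) →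
      ((P e xor Q e ≡ true) → OnBoundary f e) × (OnBoundary f e → P e xor Q e ≡ true)

  SameMatching : PerfectMatching → PerfectMatching → Set
  SameMatching (P , _) (Q , _) = (e : Edge N M) → P e ≡ Q e

  data Connected : PerfectMatching → PerfectMatching → Set where
    here : ∀ {P Q} → SameMatching P Q → Connected P Q
    step : ∀ {P Q S} → Flip P Q → Connected Q S → Connected P S

  NonIsolated : PerfectMatching → Set
  NonIsolated P = ∃ λ Q → Flip P Q

  -- the flip graph has at least K components having at least two vertices:
  -- there are K non-isolated perfect matchings lying in pairwise distinct
  -- components
  AtLeastNontrivialComponents : ℕ → Set
  AtLeastNontrivialComponents K =
    Σ (Fin K → PerfectMatching) λ rep →
      ((k : Fin K) → NonIsolated (rep k)) ×
      ((k l : Fin K) → Connected (rep k) (rep l) → k ≡ l)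

-- Two integer invariants of the flip graph separate the components: the
-- horizontal flux Σᵢ (-1)ⁱ [vᵢ,₀ vᵢ,₁ ∈ P] across column 0 and the analogous
-- vertical flux across row 0.  A flip changes P only on the boundary of one
-- face.  If that face meets a seam, the two seam edges involved are opposite
-- sides of the face, so each of the two tilings contains both or neither of
-- them; they lie in adjacent rows (columns), and since N and M are even their
-- signs are opposite, so the flux does not change.  Horizontal tilings whose
-- rows are shifted in a staggered pattern realise every horizontal flux in
-- [-(n-1), n-1] with vertical flux 0, and vertical tilings every nonzero
-- vertical flux in [-(m-1), m-1]: 2n + 2m - 3 tilings in distinct components.
-- All of them leave the first two rows (columns) unshifted, so the face at
-- the corner (0, 0) can be flipped.

module Submission where

open import Defs

open import Function using (_∘_; _$_)
open import Function.Bundles using (_↣_; Injection)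
open import Function.Properties.Inverse using (↔⇒↣)
open import Function.Construct.Composition using (_↣-∘_)
open import Data.Sum.Function.Propositional using (_⊎-↣_)
open import Data.Bool as Bool using (Bool; true; false; not; _∧_; _xor_; if_then_else_)
open import Data.Bool.Properties
  using (xor-comm; xor-assoc; xor-same; xor-identityʳ; ∧-conicalˡ; ∧-conicalʳ; not-involutive)
open import Data.Product using (Σ; _×_; _,_; proj₁; proj₂)
open import Data.Product.Properties using (≡-dec)
open import Data.Sum as Sum using (_⊎_; inj₁; inj₂)
open import Data.Nat as ℕ using (ℕ; zero; suc; _+_; _*_; _∸_; _≤_; _<_; z≤n; s≤s; parity)
import Data.Nat.Properties as ℕP
open import Data.Nat.DivMod
  using (_%_; _/_; %-distribˡ-+; m%n%n≡m%n; [m+n]%n≡m%n; m<n⇒m%n≡m; n%n≡0; m≡m%n+[m/n]*n)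
open import Data.Nat.Tactic.RingSolver as ℕSolver using ()
open import Data.Integer as ℤ using (ℤ; +_; -[1+_]; +[1+_]; _-_; -_; _⊖_; _◃_; ∣_∣)
import Data.Integer.Properties as ℤP
open import Data.Integer.Tactic.RingSolver using (solve-∀)
open import Algebra.Properties.CommutativeMonoid.Sum ℤP.+-0-commutativeMonoid
  using (sum; sum-cong-≗; sum-replicate-zero)
open import Data.Vec.Functional using (updateAt)
open import Data.Vec.Functional.Properties using (updateAt-updates; updateAt-minimal)
open import Data.Fin as Fin using (Fin; toℕ)
open import Data.Fin.Properties using (toℕ-fromℕ<; toℕ-injective; toℕ<n; suc-injective; +↔⊎)
open import Data.Parity.Base as ℙ using (Parity; 0ℙ; 1ℙ; _⁻¹; toSign)
open import Data.Parity.Properties as ℙP using (+-homo-+; *-homo-*; suc-homo-⁻¹; ⁻¹-selfInverse; p≢p⁻¹)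
open import Relation.Nullary using (¬_; Dec; yes; no; does; contradiction; _⊎-dec_)
open import Relation.Nullary.Decidable using (dec-true)
open import Relation.Binary.PropositionalEquality
open ≡-Reasoning

from-does : ∀ {A : Set} (a? : Dec A) → does a? ≡ true → A
from-does (yes a) _ = a

xor-≢true⇒≡ : ∀ x y → x xor y ≢ true → x ≡ y
xor-≢true⇒≡ false false _ = refl
xor-≢true⇒≡ false true  d = contradiction refl d
xor-≢true⇒≡ true  false d = contradiction refl d
xor-≢true⇒≡ true  true  _ = refl

xor-false-true : ∀ {x y} → y ≡ false → x xor y ≡ true → x ≡ true
xor-false-true {x} refl d = trans (sym (xor-identityʳ x)) d

does-⁻¹-≟ : ∀ p q → does (p ⁻¹ ℙP.≟ q) ≡ not (does (p ℙP.≟ q))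
does-⁻¹-≟ 0ℙ 0ℙ = refl
does-⁻¹-≟ 0ℙ 1ℙ = refl
does-⁻¹-≟ 1ℙ 0ℙ = refl
does-⁻¹-≟ 1ℙ 1ℙ = refl

parity-% : ∀ m n .{{_ : ℕ.NonZero n}} → parity n ≡ 0ℙ → parity (m % n) ≡ parity m
parity-% m n n-even = begin
  parity (m % n)                        ≡⟨ ℙP.+-identityʳ _ ⟨
  r ℙ.+ 0ℙ                              ≡⟨ cong (r ℙ.+_) (ℙP.*-zeroʳ (parity (m / n))) ⟨
  r ℙ.+ (parity (m / n) ℙ.* 0ℙ)         ≡⟨ cong (λ p → r ℙ.+ (parity (m / n) ℙ.* p)) n-even ⟨
  r ℙ.+ (parity (m / n) ℙ.* parity n)   ≡⟨ cong (r ℙ.+_) (*-homo-* (m / n) n) ⟨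
  r ℙ.+ parity (m / n * n)              ≡⟨ +-homo-+ (m % n) (m / n * n) ⟨
  parity (m % n + m / n * n)            ≡⟨ cong parity (m≡m%n+[m/n]*n m n) ⟨
  parity m                              ∎
  where
  r = parity (m % n)

parity-suc : ∀ m → parity (suc m) ≡ parity m ⁻¹
parity-suc m = sym (⁻¹-selfInverse (suc-homo-⁻¹ m))

parity-2* : ∀ m → parity (2 * m) ≡ 0ℙ
parity-2* m = *-homo-* 2 m

module _ {k : ℕ} where

  private
    K = suc k

  toℕ-addMod : (x : Fin K) (r : ℕ) → toℕ (addMod x r) ≡ (toℕ x + r) % K
  toℕ-addMod x r = toℕ-fromℕ< _

  addMod-+ : (x : Fin K) (r s : ℕ) → addMod (addMod x r) s ≡ addMod x (r + s)
  addMod-+ x r s = toℕ-injective $ begin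
    toℕ (addMod (addMod x r) s)          ≡⟨ toℕ-addMod (addMod x r) s ⟩
    (toℕ (addMod x r) + s) % K          ≡⟨ cong (λ y → (y + s) % K) (toℕ-addMod x r) ⟩
    ((toℕ x + r) % K + s) % K           ≡⟨ %-distribˡ-+ ((toℕ x + r) % K) s K ⟩
    ((toℕ x + r) % K % K + s % K) % K   ≡⟨ cong (λ y → (y + s % K) % K) (m%n%n≡m%n (toℕ x + r) K) ⟩
    ((toℕ x + r) % K + s % K) % K       ≡⟨ %-distribˡ-+ (toℕ x + r) s K ⟨
    (toℕ x + r + s) % K                 ≡⟨ cong (_% K) (ℕP.+-assoc (toℕ x) r s) ⟩
    (toℕ x + (r + s)) % K               ≡⟨ toℕ-addMod x (r + s) ⟨
    toℕ (addMod x (r + s))              ∎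

  addMod-modulus : (x : Fin K) → addMod x K ≡ x
  addMod-modulus x = toℕ-injective $ begin
    toℕ (addMod x K)   ≡⟨ toℕ-addMod x K ⟩
    (toℕ x + K) % K    ≡⟨ [m+n]%n≡m%n (toℕ x) K ⟩
    toℕ x % K          ≡⟨ m<n⇒m%n≡m (toℕ<n x) ⟩
    toℕ x              ∎

  addMod-1-k : (x : Fin K) → addMod (addMod x 1) k ≡ x
  addMod-1-k x = trans (addMod-+ x 1 k) (addMod-modulus x)

  addMod-k-1 : (x : Fin K) → addMod (addMod x k) 1 ≡ x
  addMod-k-1 x = trans (addMod-+ x k 1) (trans (cong (addMod x) (ℕP.+-comm k 1)) (addMod-modulus x))

  addMod-comm : (x : Fin K) (r s : ℕ) → addMod (addMod x r) s ≡ addMod (addMod x s) r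
  addMod-comm x r s = trans (addMod-+ x r s) (trans (cong (addMod x) (ℕP.+-comm r s)) (sym (addMod-+ x s r)))

  toℕ-addMod-zero-1 : 1 ≤ k → toℕ (addMod {K} Fin.zero 1) ≡ 1
  toℕ-addMod-zero-1 1≤k = trans (toℕ-addMod Fin.zero 1) (m<n⇒m%n≡m (s≤s 1≤k))

  addMod-1-≢ : 1 ≤ k → (x : Fin K) → addMod x 1 ≢ x
  addMod-1-≢ 1≤k x eq with ℕP.m≤n⇒m<n∨m≡n (toℕ<n x)
  ... | inj₁ 1+x<K = ℕP.1+n≢n $ begin
    suc (toℕ x)           ≡⟨ m<n⇒m%n≡m 1+x<K ⟨
    suc (toℕ x) % K       ≡⟨ cong (_% K) (ℕP.+-comm 1 (toℕ x)) ⟩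
    (toℕ x + 1) % K       ≡⟨ toℕ-addMod x 1 ⟨
    toℕ (addMod x 1)      ≡⟨ cong toℕ eq ⟩
    toℕ x                 ∎
  ... | inj₂ 1+x≡K = ℕP.<⇒≢ (s≤s 1≤k) $ begin
    1                     ≡⟨ cong suc x≡0 ⟩
    suc (toℕ x)           ≡⟨ 1+x≡K ⟩
    K                     ∎
    where
    x≡0 : 0 ≡ toℕ x
    x≡0 = begin
      0                   ≡⟨ n%n≡0 K ⟨
      K % K               ≡⟨ cong (_% K) (trans (sym 1+x≡K) (ℕP.+-comm 1 (toℕ x))) ⟩
      (toℕ x + 1) % K     ≡⟨ toℕ-addMod x 1 ⟨
      toℕ (addMod x 1)    ≡⟨ cong toℕ eq ⟩
      toℕ x               ∎

  parity-addMod-1 : parity K ≡ 0ℙ → (x : Fin K) → parity (toℕ (addMod x 1)) ≡ parity (toℕ x) ⁻¹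
  parity-addMod-1 K-even x = begin
    parity (toℕ (addMod x 1))  ≡⟨ cong parity (toℕ-addMod x 1) ⟩
    parity ((toℕ x + 1) % K)   ≡⟨ parity-% (toℕ x + 1) K K-even ⟩
    parity (toℕ x + 1)         ≡⟨ cong parity (ℕP.+-comm (toℕ x) 1) ⟩
    parity (suc (toℕ x))       ≡⟨ parity-suc (toℕ x) ⟩
    parity (toℕ x) ⁻¹          ∎

-- Finite and alternating sums

sum-diff-one-point : ∀ {n} (u v : Fin n → ℤ) (q : Fin n) →
  (∀ x → x ≢ q → u x ≡ v x) → sum u - sum v ≡ u q - v q
sum-diff-one-point u v Fin.zero agree = begin
  (u₀ ℤ.+ ∑u) - (v₀ ℤ.+ ∑v)   ≡⟨ cong (λ s → (u₀ ℤ.+ ∑u) - (v₀ ℤ.+ s)) tails ⟨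
  (u₀ ℤ.+ ∑u) - (v₀ ℤ.+ ∑u)   ≡⟨ cancel u₀ v₀ ∑u ⟩
  u₀ - v₀                     ∎
  where
  u₀ = u Fin.zero
  v₀ = v Fin.zero
  ∑u = sum (u ∘ Fin.suc)
  ∑v = sum (v ∘ Fin.suc)
  tails : ∑u ≡ ∑v
  tails = sum-cong-≗ (λ x → agree (Fin.suc x) λ ())
  cancel : ∀ a b s → (a ℤ.+ s) - (b ℤ.+ s) ≡ a - b
  cancel = solve-∀
sum-diff-one-point u v (Fin.suc q) agree = begin
  (u₀ ℤ.+ ∑u) - (v₀ ℤ.+ ∑v)   ≡⟨ cong (λ a → (u₀ ℤ.+ ∑u) - (a ℤ.+ ∑v)) (agree Fin.zero λ ()) ⟨
  (u₀ ℤ.+ ∑u) - (u₀ ℤ.+ ∑v)   ≡⟨ cancel u₀ ∑u ∑v ⟩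
  ∑u - ∑v                     ≡⟨ sum-diff-one-point (u ∘ Fin.suc) (v ∘ Fin.suc) q agree-tails ⟩
  u (Fin.suc q) - v (Fin.suc q) ∎
  where
  u₀ = u Fin.zero
  v₀ = v Fin.zero
  ∑u = sum (u ∘ Fin.suc)
  ∑v = sum (v ∘ Fin.suc)
  agree-tails : ∀ x → x ≢ q → u (Fin.suc x) ≡ v (Fin.suc x)
  agree-tails x x≢q = agree (Fin.suc x) (x≢q ∘ suc-injective)
  cancel : ∀ a s t → (a ℤ.+ s) - (a ℤ.+ t) ≡ s - t
  cancel = solve-∀

sum-diff-two-points : ∀ {n} (u v : Fin n → ℤ) (p q : Fin n) → p ≢ q →
  (∀ x → x ≢ p → x ≢ q → u x ≡ v x) → sum u - sum v ≡ (u p - v p) ℤ.+ (u q - v q)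
sum-diff-two-points u v p q p≢q agree = begin
  sum u - sum v                            ≡⟨ split (sum u) (sum w) (sum v) ⟩
  (sum u - sum w) ℤ.+ (sum w - sum v)      ≡⟨ cong₂ ℤ._+_ (sum-diff-one-point u w p u≗w)
                                                            (sum-diff-one-point w v q w≗v) ⟩
  (u p - w p) ℤ.+ (w q - v q)              ≡⟨ cong₂ (λ a b → (u p - a) ℤ.+ (b - v q))
                                                 (updateAt-updates p u) (updateAt-minimal q p u (p≢q ∘ sym)) ⟩
  (u p - v p) ℤ.+ (u q - v q)              ∎
  where
  w : Fin _ → ℤ
  w = updateAt u p (λ _ → v p)
  u≗w : ∀ x → x ≢ p → u x ≡ w x
  u≗w x x≢p = sym (updateAt-minimal x p u x≢p)
  w≗v : ∀ x → x ≢ q → w x ≡ v x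
  w≗v x x≢q with x Fin.≟ p
  ... | yes refl = updateAt-updates p u
  ... | no x≢p   = trans (updateAt-minimal x p u x≢p) (agree x x≢p x≢q)
  split : ∀ a b c → a - c ≡ (a - b) ℤ.+ (b - c)
  split = solve-∀

signedIndicator : Parity → Bool → ℤ
signedIndicator p b = if b then toSign p ◃ 1 else + 0

signedIndicator-⁻¹ : ∀ p b → signedIndicator (p ⁻¹) b ≡ - signedIndicator p b
signedIndicator-⁻¹ 0ℙ true  = refl
signedIndicator-⁻¹ 1ℙ true  = refl
signedIndicator-⁻¹ _  false = refl

alternatingSum : ∀ {n} → (Fin n → Bool) → ℤ
alternatingSum f = sum (λ i → signedIndicator (parity (toℕ i)) (f i))

alternatingSum-cong : ∀ {n} {f g : Fin n → Bool} → (∀ i → f i ≡ g i) → alternatingSum f ≡ alternatingSum g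
alternatingSum-cong f≗g = sum-cong-≗ (λ i → cong (signedIndicator _) (f≗g i))

alternatingSum-false : ∀ n → alternatingSum {n} (λ _ → false) ≡ + 0
alternatingSum-false n = sum-replicate-zero n

alternatingSum-adjacent : ∀ {k} → parity (suc k) ≡ 0ℙ → (f g : Fin (suc k) → Bool) (i : Fin (suc k)) →
  (∀ x → x ≢ i → x ≢ addMod i 1 → f x ≡ g x) → f i ≡ f (addMod i 1) → g i ≡ g (addMod i 1) →
  alternatingSum f ≡ alternatingSum g
alternatingSum-adjacent even f g i agree fᵢ≡fⱼ gᵢ≡gⱼ = ℤP.i-j≡0⇒i≡j (sum u) (sum v) $ begin
  sum u - sum v                   ≡⟨ sum-diff-two-points u v i j i≢j (λ x x≢i x≢j → cong (s x) (agree x x≢i x≢j)) ⟩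
  (u i - v i) ℤ.+ (u j - v j)     ≡⟨ cong₂ (λ a b → (u i - v i) ℤ.+ (a - b)) (opposite f fᵢ≡fⱼ) (opposite g gᵢ≡gⱼ) ⟩
  (u i - v i) ℤ.+ (- u i - - v i) ≡⟨ cancel (u i) (v i) ⟩
  + 0                             ∎
  where
  j = addMod i 1
  s : Fin _ → Bool → ℤ
  s x = signedIndicator (parity (toℕ x))
  u = λ x → s x (f x)
  v = λ x → s x (g x)
  i≢j : i ≢ j
  i≢j eq = p≢p⁻¹ (parity (toℕ i)) (trans (cong (parity ∘ toℕ) eq) (parity-addMod-1 even i))
  opposite : (h : Fin _ → Bool) → h i ≡ h j → s j (h j) ≡ - s i (h i)
  opposite h hᵢ≡hⱼ = begin
    s j (h j)                                  ≡⟨ cong₂ signedIndicator (parity-addMod-1 even i) (sym hᵢ≡hⱼ) ⟩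
    signedIndicator (parity (toℕ i) ⁻¹) (h i)  ≡⟨ signedIndicator-⁻¹ (parity (toℕ i)) (h i) ⟩
    - s i (h i)                                ∎
  cancel : ∀ a b → (a - b) ℤ.+ (- a - - b) ≡ + 0
  cancel = solve-∀

inPhase0 : (ℕ → Parity) → ∀ {n} → Fin n → Bool
inPhase0 o i = does (0ℙ ℙP.≟ o (toℕ i))

positivityPhase : ℕ → Parity
positivityPhase zero    = 1ℙ
positivityPhase (suc _) = 0ℙ

-- Row 2r gets phase 0ℙ iff r < a, row 2r + 1 iff r < b.
stagger : ℕ → ℕ → ℕ → Parity
stagger a b 0             = positivityPhase a
stagger a b 1             = positivityPhase b
stagger a b (suc (suc i)) = stagger (ℕ.pred a) (ℕ.pred b) i

alternatingSum-stagger : ∀ h {a b} → a ≤ h → b ≤ h → alternatingSum {2 * h} (inPhase0 (stagger a b)) ≡ a ⊖ b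
alternatingSum-stagger zero    z≤n z≤n = refl
alternatingSum-stagger (suc h) {a} {b} a≤ b≤ = begin
  alternatingSum {2 * suc h} (inPhase0 o)           ≡⟨ cong (λ n → alternatingSum {n} (inPhase0 o)) (ℕP.*-suc 2 h) ⟩
  alternatingSum {2 + 2 * h} (inPhase0 o)           ≡⟨ cong (λ s → row₀ a b ℤ.+ (row₁ a b ℤ.+ s))
                                                         (alternatingSum-stagger h (pred-≤ a≤) (pred-≤ b≤)) ⟩
  row₀ a b ℤ.+ (row₁ a b ℤ.+ (ℕ.pred a ⊖ ℕ.pred b))   ≡⟨ first-two-rows a b ⟩
  a ⊖ b                                              ∎
  where
  pred-≤ : ∀ {x} → x ≤ suc h → ℕ.pred x ≤ h
  pred-≤ z≤n     = z≤n
  pred-≤ (s≤s p) = p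
  o = stagger a b
  row₀ row₁ : ℕ → ℕ → ℤ
  row₀ a b = signedIndicator 0ℙ (does (0ℙ ℙP.≟ stagger a b 0))
  row₁ a b = signedIndicator 1ℙ (does (0ℙ ℙP.≟ stagger a b 1))
  first-two-rows : ∀ a b → row₀ a b ℤ.+ (row₁ a b ℤ.+ (ℕ.pred a ⊖ ℕ.pred b)) ≡ a ⊖ b
  first-two-rows zero    zero          = refl
  first-two-rows (suc a) zero          = refl
  first-two-rows zero    (suc zero)    = refl
  first-two-rows zero    (suc (suc b)) = refl
  first-two-rows (suc a) (suc b)       = trans (cancel (a ⊖ b)) (sym (ℤP.[1+m]⊖[1+n]≡m⊖n a b))
    where
    cancel : ∀ x → + 1 ℤ.+ (-[1+ 0 ] ℤ.+ x) ≡ x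
    cancel = solve-∀

staggerTo : ℤ → ℕ → Parity
staggerTo (+ x)    = stagger (suc x) 1
staggerTo -[1+ y ] = stagger 1 (suc (suc y))

staggerTo-start : ∀ z → staggerTo z 0 ≡ 0ℙ × staggerTo z 1 ≡ 0ℙ
staggerTo-start (+ _)     = refl , refl
staggerTo-start -[1+ _ ]  = refl , refl

alternatingSum-staggerTo : ∀ h z → ∣ z ∣ < h → alternatingSum {2 * h} (inPhase0 (staggerTo z)) ≡ z
alternatingSum-staggerTo h (+ x)    x<h   = alternatingSum-stagger h x<h (ℕP.≤-trans (s≤s z≤n) x<h)
alternatingSum-staggerTo h -[1+ y ] 1+y<h = alternatingSum-stagger h (ℕP.≤-trans (s≤s z≤n) 1+y<h) 1+y<h

-- Perfect matchings and flips on T(N, M, R)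

module _ {k l R : ℕ} where

  private
    N = suc k
    M = suc l
    V = Vertex N M
    E = Edge N M
    PM = PerfectMatching N M R
    Inc = Incident N M R

  MatchesAt : EdgeSet N M R → V → E → Set
  MatchesAt P v e = (P e ≡ true) × Inc v e × ((e′ : E) → P e′ ≡ true → Inc v e′ → e′ ≡ e)

  DifferExactlyOn : PM → PM → (E → Set) → Set
  DifferExactlyOn (P , _) (Q , _) S = (e : E) → ((P e xor Q e ≡ true) → S e) × (S e → P e xor Q e ≡ true)

  FlipAt : Face N M R → PM → PM → Set
  FlipAt f P Q = DifferExactlyOn P Q (OnBoundary N M R f)

  faceTop faceLeft faceRight faceBottom : Face N M R → E
  faceTop    (i , j) = (i , j , true)
  faceLeft   (i , j) = (i , j , false)
  faceRight  (i , j) = (i , addMod j 1 , false)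
  faceBottom (i , j) = (addMod i 1 , (if suc (toℕ i) ℕ.<ᵇ N then j else addMod j R) , true)

  incident-ends : ∀ {v x y} (e : E) → src N M R e ≡ x → tgt N M R e ≡ y → Inc v e → v ≡ x ⊎ v ≡ y
  incident-ends e sx ty = Sum.map (λ p → trans p sx) (λ p → trans p ty)

  module _ {P : EdgeSet N M R} (P-perfect : IsPerfectMatching N M R P) where

    matched-unique : ∀ {v a b} → P a ≡ true → P b ≡ true → Inc v a → Inc v b → a ≡ b
    matched-unique {v} {a} {b} Pa Pb va vb with P-perfect v
    ... | _ , _ , _ , unique = trans (unique a Pa va) (sym (unique b Pb vb))

    unmatched-neighbour : ∀ {v a b} → P b ≡ true → a ≢ b → Inc v a → Inc v b → P a ≡ false
    unmatched-neighbour {a = a} Pb a≢b va vb with P a in Pa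
    ... | true  = contradiction (matched-unique Pa Pb va vb) a≢b
    ... | false = refl

    matchesAt : ∀ {v o} → P o ≡ true → Inc v o → MatchesAt P v o
    matchesAt Po vo = Po , vo , λ e Pe ve → matched-unique Pe Po ve vo

  alternating-path : (P Q : PM) {a b c : E} {x y : V} → a ≢ b → c ≢ b →
    Inc x a → Inc x b → Inc y b → Inc y c →
    proj₁ P a xor proj₁ Q a ≡ true → proj₁ P b xor proj₁ Q b ≡ true → proj₁ P c xor proj₁ Q c ≡ true →
    proj₁ P a ≡ proj₁ P c
  alternating-path (P , P-perfect) (Q , Q-perfect) {a} {b} {c} a≢b c≢b xa xb yb yc Δa Δb Δc with P b in Pb
  ... | true  = trans (unmatched-neighbour P-perfect Pb a≢b xa xb) (sym (unmatched-neighbour P-perfect Pb c≢b yc yb))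
  ... | false = trans (xor-false-true Qa Δa) (sym (xor-false-true Qc Δc))
    where
    Qa = unmatched-neighbour Q-perfect Δb a≢b xa xb
    Qc = unmatched-neighbour Q-perfect Δb c≢b yc yb

  flipAt-sym : ∀ {f} (P Q : PM) → FlipAt f P Q → FlipAt f Q P
  flipAt-sym (P , _) (Q , _) H e =
    (λ Δ → proj₁ (H e) (trans (xor-comm (P e) (Q e)) Δ)) , (λ on → trans (xor-comm (Q e) (P e)) (proj₂ (H e) on))

  flipAt-agrees : ∀ {f} (P Q : PM) → FlipAt f P Q → ∀ e → ¬ OnBoundary N M R f e → proj₁ P e ≡ proj₁ Q e
  flipAt-agrees (P , _) (Q , _) H e off = xor-≢true⇒≡ (P e) (Q e) (off ∘ proj₁ (H e))

  flipAt-opposite : ∀ {f} (P Q : PM) → FlipAt f P Q →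
    proj₁ P (faceTop f) ≡ proj₁ P (faceBottom f) × proj₁ P (faceLeft f) ≡ proj₁ P (faceRight f)
  flipAt-opposite P Q H =
      alternating-path P Q (λ ()) (λ ()) (inj₁ refl) (inj₁ refl) (inj₂ refl) (inj₁ refl)
        (side (inj₁ refl)) (side (inj₂ (inj₁ refl))) (side (inj₂ (inj₂ (inj₂ refl))))
    , alternating-path P Q (λ ()) (λ ()) (inj₁ refl) (inj₁ refl) (inj₂ refl) (inj₁ refl)
        (side (inj₂ (inj₁ refl))) (side (inj₁ refl)) (side (inj₂ (inj₂ (inj₁ refl))))
    where
    side : ∀ {e} → OnBoundary N M R _ e → proj₁ P e xor proj₁ Q e ≡ true
    side {e} = proj₂ (H e)

  matchesAt-xor-away : ∀ {P B : EdgeSet N M R} {v e} → (∀ e′ → Inc v e′ → B e′ ≡ false) →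
    MatchesAt P v e → MatchesAt (λ e′ → P e′ xor B e′) v e
  matchesAt-xor-away {P} {B} {v} off (Pe , ve , unique) =
    trans (unchanged ve) Pe , ve , λ e′ Qe′ ve′ → unique e′ (trans (sym (unchanged ve′)) Qe′) ve′
    where
    unchanged : ∀ {e′} → Inc v e′ → P e′ xor B e′ ≡ P e′
    unchanged {e′} ve′ = trans (cong (P e′ xor_) (off e′ ve′)) (xor-identityʳ (P e′))

  matchesAt-xor-corner : ∀ {P B : EdgeSet N M R} {v o g} → MatchesAt P v o → B o ≡ true →
    Inc v g → B g ≡ true → P g ≡ false → (∀ e → B e ≡ true → Inc v e → e ≡ o ⊎ e ≡ g) →
    MatchesAt (λ e → P e xor B e) v g
  matchesAt-xor-corner {P} {B} {v} {o} {g} (Po , vo , unique) Bo vg Bg Pg only = cong₂ _xor_ Pg Bg , vg , only-g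
    where
    only-g : ∀ e → P e xor B e ≡ true → Inc v e → e ≡ g
    only-g e Qe ve with B e in Be
    ... | false = contradiction (trans (sym Bo) (trans (cong B (sym (unique e (xor-false-true refl Qe) ve))) Be)) λ ()
    ... | true with only e Be ve
    ...   | inj₂ e≡g  = e≡g
    ...   | inj₁ refl = contradiction (trans (sym (cong (_xor true) Po)) Qe) λ ()

  Joins : E → V → V → Set
  Joins e x y = src N M R e ≡ x × tgt N M R e ≡ y

  avoids : ∀ {e x y v} → Joins e x y → v ≢ x → v ≢ y → ¬ Inc v e
  avoids {e} (sx , ty) v≢x v≢y = Sum.[ v≢x , v≢y ] ∘ incident-ends e sx ty

  -- A 4-cycle x₁ x₂ x₄ x₃ of the torus graph, drawn with x₁ x₂ on top.
  record Square : Set where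
    field
      top left right bottom : E
      x₁ x₂ x₃ x₄ : V
      top-joins    : Joins top x₁ x₂
      left-joins   : Joins left x₁ x₃
      right-joins  : Joins right x₂ x₄
      bottom-joins : Joins bottom x₃ x₄
      x₁≢x₂ : x₁ ≢ x₂
      x₁≢x₃ : x₁ ≢ x₃
      x₁≢x₄ : x₁ ≢ x₄
      x₂≢x₃ : x₂ ≢ x₃
      x₂≢x₄ : x₂ ≢ x₄
      x₃≢x₄ : x₃ ≢ x₄

    IsSide : E → Set
    IsSide e = e ≡ top ⊎ e ≡ left ⊎ e ≡ right ⊎ e ≡ bottom

  transpose : Square → Square
  transpose S = record
    { top = left ; left = top ; right = bottom ; bottom = right
    ; x₁ = x₁ ; x₂ = x₃ ; x₃ = x₂ ; x₄ = x₄
    ; top-joins = left-joins ; left-joins = top-joins ; right-joins = bottom-joins ; bottom-joins = right-joins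
    ; x₁≢x₂ = x₁≢x₃ ; x₁≢x₃ = x₁≢x₂ ; x₁≢x₄ = x₁≢x₄
    ; x₂≢x₃ = x₂≢x₃ ∘ sym ; x₂≢x₄ = x₃≢x₄ ; x₃≢x₄ = x₂≢x₄
    }
    where open Square S

  isSide-transpose : ∀ S {e} → Square.IsSide (transpose S) e → Square.IsSide S e
  isSide-transpose S (inj₁ e≡left)                   = inj₂ (inj₁ e≡left)
  isSide-transpose S (inj₂ (inj₁ e≡top))             = inj₁ e≡top
  isSide-transpose S (inj₂ (inj₂ (inj₁ e≡bottom)))   = inj₂ (inj₂ (inj₂ e≡bottom))
  isSide-transpose S (inj₂ (inj₂ (inj₂ e≡right)))    = inj₂ (inj₂ (inj₁ e≡right))

  _≟ᵥ_ : (u v : V) → Dec (u ≡ v)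
  _≟ᵥ_ = ≡-dec Fin._≟_ Fin._≟_

  _≟ₑ_ : (e e′ : E) → Dec (e ≡ e′)
  _≟ₑ_ = ≡-dec Fin._≟_ (≡-dec Fin._≟_ Bool._≟_)

  module _ (S : Square) where

    open Square S

    isSide? : ∀ e → Dec (IsSide e)
    isSide? e = (e ≟ₑ top) ⊎-dec (e ≟ₑ left) ⊎-dec (e ≟ₑ right) ⊎-dec (e ≟ₑ bottom)

    sides : EdgeSet N M R
    sides e = does (isSide? e)

    isSide⇒sides : ∀ {e} → IsSide e → sides e ≡ true
    isSide⇒sides {e} = dec-true (isSide? e)

    sides⇒isSide : ∀ {e} → sides e ≡ true → IsSide e
    sides⇒isSide {e} = from-does (isSide? e)

    module _ {P : EdgeSet N M R} (P-perfect : IsPerfectMatching N M R P)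
             (P-top : P top ≡ true) (P-bottom : P bottom ≡ true) where

      private
        Q : EdgeSet N M R
        Q e = P e xor sides e

        x₁∈top : Inc x₁ top
        x₁∈top = inj₁ (sym (proj₁ top-joins))
        x₂∈top : Inc x₂ top
        x₂∈top = inj₂ (sym (proj₂ top-joins))
        x₁∈left : Inc x₁ left
        x₁∈left = inj₁ (sym (proj₁ left-joins))
        x₃∈left : Inc x₃ left
        x₃∈left = inj₂ (sym (proj₂ left-joins))
        x₂∈right : Inc x₂ right
        x₂∈right = inj₁ (sym (proj₁ right-joins))
        x₄∈right : Inc x₄ right
        x₄∈right = inj₂ (sym (proj₂ right-joins))
        x₃∈bottom : Inc x₃ bottom
        x₃∈bottom = inj₁ (sym (proj₁ bottom-joins))
        x₄∈bottom : Inc x₄ bottom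
        x₄∈bottom = inj₂ (sym (proj₂ bottom-joins))

        P-left : P left ≡ false
        P-left = unmatched-neighbour P-perfect P-top (x₃≢x₂ ∘ cong (tgt N M R)) x₁∈left x₁∈top
          where
          x₃≢x₂ : tgt N M R left ≢ tgt N M R top
          x₃≢x₂ eq = x₂≢x₃ (trans (sym (proj₂ top-joins)) (trans (sym eq) (proj₂ left-joins)))

        P-right : P right ≡ false
        P-right = unmatched-neighbour P-perfect P-top (x₂≢x₁ ∘ cong (src N M R)) x₂∈right x₂∈top
          where
          x₂≢x₁ : src N M R right ≢ src N M R top
          x₂≢x₁ eq = x₁≢x₂ (trans (sym (proj₁ top-joins)) (trans (sym eq) (proj₁ right-joins)))

        corner : ∀ {v o g} → P o ≡ true → Inc v o → IsSide o → Inc v g → IsSide g → P g ≡ false →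
          (∀ e → IsSide e → Inc v e → e ≡ o ⊎ e ≡ g) → MatchesAt Q v g
        corner Po vo o-side vg g-side Pg only =
          matchesAt-xor-corner (matchesAt P-perfect Po vo) (isSide⇒sides o-side) vg (isSide⇒sides g-side) Pg
            (λ e e-side → only e (sides⇒isSide e-side))

        at-x₁ : ∀ e → IsSide e → Inc x₁ e → e ≡ top ⊎ e ≡ left
        at-x₁ e (inj₁ e≡top)               _  = inj₁ e≡top
        at-x₁ e (inj₂ (inj₁ e≡left))       _  = inj₂ e≡left
        at-x₁ e (inj₂ (inj₂ (inj₁ refl)))  ve = contradiction ve (avoids right-joins x₁≢x₂ x₁≢x₄)
        at-x₁ e (inj₂ (inj₂ (inj₂ refl)))  ve = contradiction ve (avoids bottom-joins x₁≢x₃ x₁≢x₄)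

        at-x₂ : ∀ e → IsSide e → Inc x₂ e → e ≡ top ⊎ e ≡ right
        at-x₂ e (inj₁ e≡top)               _  = inj₁ e≡top
        at-x₂ e (inj₂ (inj₁ refl))         ve = contradiction ve (avoids left-joins (x₁≢x₂ ∘ sym) x₂≢x₃)
        at-x₂ e (inj₂ (inj₂ (inj₁ e≡right))) _ = inj₂ e≡right
        at-x₂ e (inj₂ (inj₂ (inj₂ refl)))  ve = contradiction ve (avoids bottom-joins x₂≢x₃ x₂≢x₄)

        at-x₃ : ∀ e → IsSide e → Inc x₃ e → e ≡ bottom ⊎ e ≡ left
        at-x₃ e (inj₁ refl)                ve = contradiction ve (avoids top-joins (x₁≢x₃ ∘ sym) (x₂≢x₃ ∘ sym))
        at-x₃ e (inj₂ (inj₁ e≡left))       _  = inj₂ e≡left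
        at-x₃ e (inj₂ (inj₂ (inj₁ refl)))  ve = contradiction ve (avoids right-joins (x₂≢x₃ ∘ sym) x₃≢x₄)
        at-x₃ e (inj₂ (inj₂ (inj₂ e≡bottom))) _ = inj₁ e≡bottom

        at-x₄ : ∀ e → IsSide e → Inc x₄ e → e ≡ bottom ⊎ e ≡ right
        at-x₄ e (inj₁ refl)                ve = contradiction ve (avoids top-joins (x₁≢x₄ ∘ sym) (x₂≢x₄ ∘ sym))
        at-x₄ e (inj₂ (inj₁ refl))         ve = contradiction ve (avoids left-joins (x₁≢x₄ ∘ sym) (x₃≢x₄ ∘ sym))
        at-x₄ e (inj₂ (inj₂ (inj₁ e≡right))) _ = inj₂ e≡right
        at-x₄ e (inj₂ (inj₂ (inj₂ e≡bottom))) _ = inj₁ e≡bottom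

        away : ∀ {v} → v ≢ x₁ → v ≢ x₂ → v ≢ x₃ → v ≢ x₄ → ∀ e → Inc v e → sides e ≡ false
        away {v} v≢x₁ v≢x₂ v≢x₃ v≢x₄ e ve with sides e in side-e
        ... | false = refl
        ... | true  with sides⇒isSide {e} side-e
        ...   | inj₁ refl                 = contradiction ve (avoids top-joins v≢x₁ v≢x₂)
        ...   | inj₂ (inj₁ refl)          = contradiction ve (avoids left-joins v≢x₁ v≢x₃)
        ...   | inj₂ (inj₂ (inj₁ refl))   = contradiction ve (avoids right-joins v≢x₂ v≢x₄)
        ...   | inj₂ (inj₂ (inj₂ refl))   = contradiction ve (avoids bottom-joins v≢x₃ v≢x₄)

        top-side : IsSide top
        top-side = inj₁ refl
        left-side : IsSide left
        left-side = inj₂ (inj₁ refl)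
        right-side : IsSide right
        right-side = inj₂ (inj₂ (inj₁ refl))
        bottom-side : IsSide bottom
        bottom-side = inj₂ (inj₂ (inj₂ refl))

      flipped-isPerfectMatching : IsPerfectMatching N M R Q
      flipped-isPerfectMatching v with v ≟ᵥ x₁ | v ≟ᵥ x₂ | v ≟ᵥ x₃ | v ≟ᵥ x₄
      ... | yes refl | _ | _ | _ = left , corner P-top x₁∈top top-side x₁∈left left-side P-left at-x₁
      ... | no _ | yes refl | _ | _ = right , corner P-top x₂∈top top-side x₂∈right right-side P-right at-x₂
      ... | no _ | no _ | yes refl | _ = left , corner P-bottom x₃∈bottom bottom-side x₃∈left left-side P-left at-x₃
      ... | no _ | no _ | no _ | yes refl = right , corner P-bottom x₄∈bottom bottom-side x₄∈right right-side P-right at-x₄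
      ... | no v≢x₁ | no v≢x₂ | no v≢x₃ | no v≢x₄ =
        let (e , P-at-v) = P-perfect v in e , matchesAt-xor-away (away v≢x₁ v≢x₂ v≢x₃ v≢x₄) P-at-v

      flipped-differs : ∀ e → P e xor Q e ≡ sides e
      flipped-differs e = trans (sym (xor-assoc (P e) (P e) (sides e))) (cong (_xor sides e) (xor-same (P e)))

  flipSquare : (S : Square) (P : PM) → proj₁ P (Square.top S) ≡ true → proj₁ P (Square.bottom S) ≡ true →
    Σ PM λ Q → DifferExactlyOn P Q (Square.IsSide S)
  flipSquare S (P , P-perfect) P-top P-bottom =
      ((λ e → P e xor sides S e) , flipped-isPerfectMatching S P-perfect P-top P-bottom)
    , λ e → (λ Δ → sides⇒isSide S (trans (sym (flipped-differs S P-perfect P-top P-bottom e)) Δ))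
          , (λ side → trans (flipped-differs S P-perfect P-top P-bottom e) (isSide⇒sides S side))

  wrapped-addMod-1 : (c : Bool) (j : Fin M) →
    (if c then addMod j 1 else addMod (addMod j 1) R) ≡ addMod (if c then j else addMod j R) 1
  wrapped-addMod-1 true  j = refl
  wrapped-addMod-1 false j = addMod-comm j 1 R

  faceSquare : 1 ≤ k → 1 ≤ l → Face N M R → Square
  faceSquare 1≤k 1≤l (i , j) = record
    { top = faceTop (i , j) ; left = faceLeft (i , j) ; right = faceRight (i , j) ; bottom = faceBottom (i , j)
    ; x₁ = (i , j) ; x₂ = (i , addMod j 1) ; x₃ = (addMod i 1 , j′) ; x₄ = (addMod i 1 , addMod j′ 1)
    ; top-joins    = refl , refl
    ; left-joins   = refl , refl
    ; right-joins  = refl , cong (addMod i 1 ,_) (wrapped-addMod-1 (suc (toℕ i) ℕ.<ᵇ N) j)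
    ; bottom-joins = refl , refl
    ; x₁≢x₂ = columns-differ ; x₁≢x₃ = rows-differ ; x₁≢x₄ = rows-differ
    ; x₂≢x₃ = rows-differ ; x₂≢x₄ = rows-differ ; x₃≢x₄ = columns-differ
    }
    where
    j′ = if suc (toℕ i) ℕ.<ᵇ N then j else addMod j R
    rows-differ : ∀ {a b} → (i , a) ≢ (addMod i 1 , b)
    rows-differ = addMod-1-≢ 1≤k i ∘ sym ∘ cong proj₁
    columns-differ : ∀ {a c} → (a , c) ≢ (a , addMod c 1)
    columns-differ {c = c} = addMod-1-≢ 1≤l c ∘ sym ∘ cong proj₂

  nonIsolated-horizontal : 1 ≤ k → 1 ≤ l → ∀ f (P : PM) →
    proj₁ P (faceTop f) ≡ true → proj₁ P (faceBottom f) ≡ true → NonIsolated N M R P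
  nonIsolated-horizontal 1≤k 1≤l f P P-top P-bottom =
    let (Q , Δ) = flipSquare (faceSquare 1≤k 1≤l f) P P-top P-bottom in Q , f , Δ

  nonIsolated-vertical : 1 ≤ k → 1 ≤ l → ∀ f (P : PM) →
    proj₁ P (faceLeft f) ≡ true → proj₁ P (faceRight f) ≡ true → NonIsolated N M R P
  nonIsolated-vertical 1≤k 1≤l f P P-left P-right =
    let (Q , Δ) = flipSquare (transpose S) P P-left P-right
    in Q , f , λ e → isSide-transpose S ∘ proj₁ (Δ e) , proj₂ (Δ e) ∘ isSide-transpose (transpose S)
    where
    S = faceSquare 1≤k 1≤l f

  lineMatching : Bool → (V → Bool) → EdgeSet N M R
  lineMatching d φ (i , j , d′) = does (d′ Bool.≟ d) ∧ φ (i , j)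

  lineMatching-true : ∀ {d φ} (e : E) → lineMatching d φ e ≡ true →
    proj₂ (proj₂ e) ≡ d × φ (src N M R e) ≡ true
  lineMatching-true {d} (_ , _ , d′) L = from-does (d′ Bool.≟ d) (∧-conicalˡ _ _ L) , ∧-conicalʳ _ _ L

  lineMatching-chosen : ∀ {d φ} v → φ v ≡ true → lineMatching d φ (proj₁ v , proj₂ v , d) ≡ true
  lineMatching-chosen {d} v φv = cong₂ _∧_ (dec-true (d Bool.≟ d) refl) φv

  next : Bool → V → V
  next d (i , j) = tgt N M R (i , j , d)

  lineMatching-isPerfectMatching : ∀ d (φ : V → Bool) (back : V → V) →
    (∀ v → back (next d v) ≡ v) → (∀ v → next d (back v) ≡ v) → (∀ v → φ (next d v) ≡ not (φ v)) →
    IsPerfectMatching N M R (lineMatching d φ)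
  lineMatching-isPerfectMatching d φ back back-next next-back φ-next v with φ v in φv
  ... | true  = (proj₁ v , proj₂ v , d) , lineMatching-chosen {d} {φ} v φv , inj₁ refl , only
    where
    only : ∀ e → lineMatching d φ e ≡ true → Inc v e → e ≡ (proj₁ v , proj₂ v , d)
    only (i , j , d′) L v∈e with refl , φij ← lineMatching-true {d} {φ} (i , j , d′) L | v∈e
    ... | inj₁ refl   = refl
    ... | inj₂ v≡next = contradiction φv-false λ ()
      where
      φv-false : true ≡ false
      φv-false = begin
        true               ≡⟨ φv ⟨
        φ v                ≡⟨ cong φ v≡next ⟩
        φ (next d (i , j)) ≡⟨ φ-next (i , j) ⟩
        not (φ (i , j))    ≡⟨ cong not φij ⟩
        false              ∎
  ... | false = (proj₁ u , proj₂ u , d) , lineMatching-chosen {d} {φ} u φu , inj₂ (sym (next-back v)) , only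
    where
    u = back v
    φu : φ u ≡ true
    φu = trans (sym (not-involutive (φ u))) (cong not (trans (sym (φ-next u)) (trans (cong φ (next-back v)) φv)))
    only : ∀ e → lineMatching d φ e ≡ true → Inc v e → e ≡ (proj₁ u , proj₂ u , d)
    only (i , j , d′) L v∈e with refl , φij ← lineMatching-true {d} {φ} (i , j , d′) L | v∈e
    ... | inj₁ refl   = contradiction (trans (sym φv) φij) λ ()
    ... | inj₂ v≡next =
      cong (λ w → (proj₁ w , proj₂ w , d)) (trans (sym (back-next (i , j))) (cong back (sym v≡next)))

  verticalFlux : Fin N → EdgeSet N M R → ℤ
  verticalFlux i₀ P = alternatingSum (λ j → P (i₀ , j , false))

  vertical-onBoundary : ∀ {i j i′ j′} → OnBoundary N M R (i , j) (i′ , j′ , false) →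
    i′ ≡ i × (j′ ≡ j ⊎ j′ ≡ addMod j 1)
  vertical-onBoundary (inj₁ ())
  vertical-onBoundary (inj₂ (inj₁ refl))         = refl , inj₁ refl
  vertical-onBoundary (inj₂ (inj₂ (inj₁ refl)))  = refl , inj₂ refl
  vertical-onBoundary (inj₂ (inj₂ (inj₂ ())))

  verticalFlux-flipAt : parity M ≡ 0ℙ → ∀ i₀ {f} (P Q : PM) → FlipAt f P Q →
    verticalFlux i₀ (proj₁ P) ≡ verticalFlux i₀ (proj₁ Q)
  verticalFlux-flipAt M-even i₀ {i , j} P Q H with i Fin.≟ i₀
  ... | no i≢i₀  = alternatingSum-cong λ j′ →
        flipAt-agrees P Q H (i₀ , j′ , false) (i≢i₀ ∘ sym ∘ proj₁ ∘ vertical-onBoundary)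
  ... | yes refl = alternatingSum-adjacent M-even _ _ j
        (λ j′ j′≢j j′≢j+1 →
          flipAt-agrees P Q H (i , j′ , false) (Sum.[ j′≢j , j′≢j+1 ] ∘ proj₂ ∘ vertical-onBoundary))
        (proj₂ (flipAt-opposite P Q H)) (proj₂ (flipAt-opposite Q P (flipAt-sym P Q H)))

  connected-invariant : ∀ {A : Set} (inv : EdgeSet N M R → A) → (∀ {P Q} → (∀ e → P e ≡ Q e) → inv P ≡ inv Q) →
    (∀ {f} (P Q : PM) → FlipAt f P Q → inv (proj₁ P) ≡ inv (proj₁ Q)) →
    ∀ {P Q} → Connected N M R P Q → inv (proj₁ P) ≡ inv (proj₁ Q)
  connected-invariant inv inv-ext inv-flip (here same)         = inv-ext same
  connected-invariant inv inv-ext inv-flip (step {P} {Q} (_ , H) rest) =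
    trans (inv-flip P Q H) (connected-invariant inv inv-ext inv-flip rest)

  atLeastNontrivialComponents : ∀ {K} {I A : Set} (inv : PM → A) → (∀ {P Q} → Connected N M R P Q → inv P ≡ inv Q) →
    (rep : I → PM) → (∀ x → NonIsolated N M R (rep x)) → (∀ x y → inv (rep x) ≡ inv (rep y) → x ≡ y) →
    Fin K ↣ I → AtLeastNontrivialComponents N M R K
  atLeastNontrivialComponents inv inv-connected rep rep-nonIsolated inv-rep-injective index =
    rep ∘ to , rep-nonIsolated ∘ to , λ x y c → injective (inv-rep-injective _ _ (inv-connected c))
    where open Injection index

-- The torus T(2n, 2m, 2m)

signed : ∀ {a b} → Fin a ⊎ Fin b → ℤ
signed (inj₁ x) = + toℕ x
signed (inj₂ y) = -[1+ toℕ y ]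

signed-injective : ∀ {a b} (x y : Fin a ⊎ Fin b) → signed x ≡ signed y → x ≡ y
signed-injective (inj₁ x) (inj₁ y) eq = cong inj₁ (toℕ-injective (ℤP.+-injective eq))
signed-injective (inj₂ x) (inj₂ y) eq = cong inj₂ (toℕ-injective (ℤP.-[1+-injective eq))
signed-injective (inj₁ _) (inj₂ _) ()
signed-injective (inj₂ _) (inj₁ _) ()

∣signed∣< : ∀ {c} (x : Fin (suc c) ⊎ Fin c) → ∣ signed x ∣ < suc c
∣signed∣< (inj₁ x) = toℕ<n x
∣signed∣< (inj₂ y) = s≤s (toℕ<n y)

signedNonzero : ∀ {a b} → Fin a ⊎ Fin b → ℤ
signedNonzero (inj₁ x) = +[1+ toℕ x ]
signedNonzero (inj₂ y) = -[1+ toℕ y ]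

signedNonzero-injective : ∀ {a b} (x y : Fin a ⊎ Fin b) → signedNonzero x ≡ signedNonzero y → x ≡ y
signedNonzero-injective (inj₁ x) (inj₁ y) eq = cong inj₁ (toℕ-injective (ℤP.+[1+-injective eq))
signedNonzero-injective (inj₂ x) (inj₂ y) eq = cong inj₂ (toℕ-injective (ℤP.-[1+-injective eq))
signedNonzero-injective (inj₁ _) (inj₂ _) ()
signedNonzero-injective (inj₂ _) (inj₁ _) ()

signedNonzero-≢0 : ∀ {a b} (x : Fin a ⊎ Fin b) → + 0 ≢ signedNonzero x
signedNonzero-≢0 (inj₁ _) ()
signedNonzero-≢0 (inj₂ _) ()

∣signedNonzero∣< : ∀ {c} (x : Fin c ⊎ Fin c) → ∣ signedNonzero x ∣ < suc c
∣signedNonzero∣< (inj₁ x) = s≤s (toℕ<n x)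
∣signedNonzero∣< (inj₂ y) = s≤s (toℕ<n y)

splitFin : ∀ {a b c d} → Fin ((a + b) + (c + d)) ↣ ((Fin a ⊎ Fin b) ⊎ (Fin c ⊎ Fin d))
splitFin {a} {b} {c} {d} =
  (↔⇒↣ (+↔⊎ {a} {b}) ⊎-↣ ↔⇒↣ (+↔⊎ {c} {d})) ↣-∘ ↔⇒↣ (+↔⊎ {a + b} {c + d})

module EvenTorus (p q : ℕ) where

  private
    N = 2 * suc p
    M = 2 * suc q
    PM = PerfectMatching N M M

    N-even : parity N ≡ 0ℙ
    N-even = parity-2* (suc p)

    M-even : parity M ≡ 0ℙ
    M-even = parity-2* (suc q)

    N≥2 : 1 ≤ ℕ.pred N
    N≥2 = ℕP.≤-trans (s≤s z≤n) (ℕP.m≤n+m _ p)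

    M≥2 : 1 ≤ ℕ.pred M
    M≥2 = ℕP.≤-trans (s≤s z≤n) (ℕP.m≤n+m _ q)

  unwrapped : (b : Bool) (j : Fin M) → (if b then j else addMod j M) ≡ j
  unwrapped true  j = refl
  unwrapped false j = addMod-modulus j

  horizontal-onBoundary : ∀ {i j i′ j′} → OnBoundary N M M (i , j) (i′ , j′ , true) →
    (i′ ≡ i ⊎ i′ ≡ addMod i 1) × j′ ≡ j
  horizontal-onBoundary (inj₁ refl)                = inj₁ refl , refl
  horizontal-onBoundary (inj₂ (inj₁ ()))
  horizontal-onBoundary (inj₂ (inj₂ (inj₁ ())))
  horizontal-onBoundary (inj₂ (inj₂ (inj₂ refl)))  = inj₂ refl , unwrapped _ _

  horizontalFlux : Fin M → EdgeSet N M M → ℤ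
  horizontalFlux j₀ P = alternatingSum (λ i → P (i , j₀ , true))

  horizontalFlux-flipAt : ∀ j₀ {f} (P Q : PM) → FlipAt f P Q →
    horizontalFlux j₀ (proj₁ P) ≡ horizontalFlux j₀ (proj₁ Q)
  horizontalFlux-flipAt j₀ {i , j} P Q H with j Fin.≟ j₀
  ... | no j≢j₀  = alternatingSum-cong λ i′ →
        flipAt-agrees P Q H (i′ , j₀ , true) (j≢j₀ ∘ sym ∘ proj₂ ∘ horizontal-onBoundary)
  ... | yes refl = alternatingSum-adjacent N-even _ _ i
        (λ i′ i′≢i i′≢i+1 →
          flipAt-agrees P Q H (i′ , j , true) (Sum.[ i′≢i , i′≢i+1 ] ∘ proj₁ ∘ horizontal-onBoundary))
        (top≡bottom P Q H) (top≡bottom Q P (flipAt-sym P Q H))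
    where
    top≡bottom : (P Q : PM) → FlipAt (i , j) P Q → proj₁ P (i , j , true) ≡ proj₁ P (addMod i 1 , j , true)
    top≡bottom P Q H = trans (proj₁ (flipAt-opposite P Q H))
                             (cong (λ c → proj₁ P (addMod i 1 , c , true)) (unwrapped (suc (toℕ i) ℕ.<ᵇ N) j))

  flux : EdgeSet N M M → ℤ × ℤ
  flux P = horizontalFlux Fin.zero P , verticalFlux {R = M} Fin.zero P

  flux-connected : ∀ {P Q} → Connected N M M P Q → flux (proj₁ P) ≡ flux (proj₁ Q)
  flux-connected = connected-invariant flux
    (λ same → cong₂ _,_ (alternatingSum-cong λ i → same (i , Fin.zero , true))
                         (alternatingSum-cong λ j → same (Fin.zero , j , false)))
    (λ P Q H → cong₂ _,_ (horizontalFlux-flipAt Fin.zero P Q H) (verticalFlux-flipAt M-even Fin.zero P Q H))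

  horizontalTiling : (ℕ → Parity) → PM
  horizontalTiling o = lineMatching {R = M} true φ , lineMatching-isPerfectMatching true φ back back-next next-back φ-next
    where
    φ : Vertex N M → Bool
    φ (i , j) = does (parity (toℕ j) ℙP.≟ o (toℕ i))
    back : Vertex N M → Vertex N M
    back (i , j) = i , addMod j (ℕ.pred M)
    back-next : ∀ v → back (next {R = M} true v) ≡ v
    back-next (i , j) = cong (i ,_) (addMod-1-k j)
    next-back : ∀ v → next {R = M} true (back v) ≡ v
    next-back (i , j) = cong (i ,_) (addMod-k-1 j)
    φ-next : ∀ v → φ (next {R = M} true v) ≡ not (φ v)
    φ-next (i , j) = trans (cong (λ r → does (r ℙP.≟ o (toℕ i))) (parity-addMod-1 M-even j))
                           (does-⁻¹-≟ (parity (toℕ j)) (o (toℕ i)))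

  verticalTiling : (ℕ → Parity) → PM
  verticalTiling o = lineMatching {R = M} false φ , lineMatching-isPerfectMatching false φ back back-next next-back φ-next
    where
    φ : Vertex N M → Bool
    φ (i , j) = does (parity (toℕ i) ℙP.≟ o (toℕ j))
    back : Vertex N M → Vertex N M
    back (i , j) = addMod i (ℕ.pred N) , j
    back-next : ∀ v → back (next {R = M} false v) ≡ v
    back-next (i , j) = cong₂ _,_ (addMod-1-k i) (unwrapped _ j)
    next-back : ∀ v → next {R = M} false (back v) ≡ v
    next-back (i , j) = cong₂ _,_ (addMod-k-1 i) (unwrapped _ j)
    φ-next : ∀ v → φ (next {R = M} false v) ≡ not (φ v)
    φ-next (i , j) = trans (cong₂ (λ r c → does (r ℙP.≟ o (toℕ c))) (parity-addMod-1 N-even i) (unwrapped _ j))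
                           (does-⁻¹-≟ (parity (toℕ i)) (o (toℕ j)))

  flux-horizontalTiling : ∀ o → flux (proj₁ (horizontalTiling o)) ≡ (alternatingSum {N} (inPhase0 o) , + 0)
  flux-horizontalTiling o = cong (alternatingSum {N} (inPhase0 o) ,_) (alternatingSum-false M)

  flux-verticalTiling : ∀ o → flux (proj₁ (verticalTiling o)) ≡ (+ 0 , alternatingSum {M} (inPhase0 o))
  flux-verticalTiling o = cong (_, alternatingSum {M} (inPhase0 o)) (alternatingSum-false N)

  horizontalTiling-nonIsolated : ∀ o → o 0 ≡ 0ℙ → o 1 ≡ 0ℙ → NonIsolated N M M (horizontalTiling o)
  horizontalTiling-nonIsolated o o₀ o₁ =
    nonIsolated-horizontal N≥2 M≥2 (Fin.zero , Fin.zero) (horizontalTiling o)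
      (dec-true (0ℙ ℙP.≟ o 0) (sym o₀))
      (trans (cong₂ (λ c r → does (parity (toℕ c) ℙP.≟ o r))
                    (unwrapped (1 ℕ.<ᵇ N) Fin.zero) (toℕ-addMod-zero-1 N≥2))
             (dec-true (0ℙ ℙP.≟ o 1) (sym o₁)))

  verticalTiling-nonIsolated : ∀ o → o 0 ≡ 0ℙ → o 1 ≡ 0ℙ → NonIsolated N M M (verticalTiling o)
  verticalTiling-nonIsolated o o₀ o₁ =
    nonIsolated-vertical N≥2 M≥2 (Fin.zero , Fin.zero) (verticalTiling o)
      (dec-true (0ℙ ℙP.≟ o 0) (sym o₀))
      (trans (cong (λ c → does (0ℙ ℙP.≟ o c)) (toℕ-addMod-zero-1 M≥2)) (dec-true (0ℙ ℙP.≟ o 1) (sym o₁)))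

  Index : Set
  Index = (Fin (suc p) ⊎ Fin p) ⊎ (Fin q ⊎ Fin q)

  expectedFlux : Index → ℤ × ℤ
  expectedFlux (inj₁ x) = signed x , + 0
  expectedFlux (inj₂ y) = + 0 , signedNonzero y

  expectedFlux-injective : ∀ x y → expectedFlux x ≡ expectedFlux y → x ≡ y
  expectedFlux-injective (inj₁ x) (inj₁ y) eq = cong inj₁ (signed-injective x y (cong proj₁ eq))
  expectedFlux-injective (inj₂ x) (inj₂ y) eq = cong inj₂ (signedNonzero-injective x y (cong proj₂ eq))
  expectedFlux-injective (inj₁ x) (inj₂ y) eq = contradiction (cong proj₂ eq) (signedNonzero-≢0 y)
  expectedFlux-injective (inj₂ x) (inj₁ y) eq = contradiction (sym (cong proj₂ eq)) (signedNonzero-≢0 x)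

  tiling : Index → PM
  tiling (inj₁ x) = horizontalTiling (staggerTo (signed x))
  tiling (inj₂ y) = verticalTiling (staggerTo (signedNonzero y))

  tiling-nonIsolated : ∀ x → NonIsolated N M M (tiling x)
  tiling-nonIsolated (inj₁ x) = let (o₀ , o₁) = staggerTo-start (signed x) in
    horizontalTiling-nonIsolated (staggerTo (signed x)) o₀ o₁
  tiling-nonIsolated (inj₂ y) = let (o₀ , o₁) = staggerTo-start (signedNonzero y) in
    verticalTiling-nonIsolated (staggerTo (signedNonzero y)) o₀ o₁

  flux-tiling : ∀ x → flux (proj₁ (tiling x)) ≡ expectedFlux x
  flux-tiling (inj₁ x) = trans (flux-horizontalTiling (staggerTo (signed x)))
    (cong (_, + 0) (alternatingSum-staggerTo (suc p) (signed x) (∣signed∣< x)))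
  flux-tiling (inj₂ y) = trans (flux-verticalTiling (staggerTo (signedNonzero y)))
    (cong (+ 0 ,_) (alternatingSum-staggerTo (suc q) (signedNonzero y) (∣signedNonzero∣< y)))

  tilings-separated : ∀ x y → flux (proj₁ (tiling x)) ≡ flux (proj₁ (tiling y)) → x ≡ y
  tilings-separated x y eq = expectedFlux-injective x y (trans (sym (flux-tiling x)) (trans eq (flux-tiling y)))

  nontrivialComponents : AtLeastNontrivialComponents N M M ((suc p + p) + (q + q))
  nontrivialComponents =
    atLeastNontrivialComponents (flux ∘ proj₁) flux-connected tiling tiling-nonIsolated tilings-separated splitFin

theorem4p9 : (n m : ℕ) → 2 ≤ n → 2 ≤ m →
    AtLeastNontrivialComponents (2 * n) (2 * m) (2 * m) (2 * n + 2 * m ∸ 3)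
theorem4p9 (suc p) (suc q) (s≤s _) (s≤s _) =
  subst (AtLeastNontrivialComponents (2 * suc p) (2 * suc q) (2 * suc q)) (sym count) (EvenTorus.nontrivialComponents p q)
  where
  count : 2 * suc p + 2 * suc q ∸ 3 ≡ (suc p + p) + (q + q)
  count = cong (_∸ 3) (identity p q)
    where
    identity : ∀ a b → 2 * (1 + a) + 2 * (1 + b) ≡ 3 + ((1 + a + a) + (b + b))
    identity = ℕSolver.solve-∀
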